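{- Let $G$ be a $d$-dimensional geometric graph and let $K$ be a complete subgraph of $G$ with $k\ge1$ vertices (a copy of $K_k$). Then the dual graph $\hat K$ of $K$ in $G$ is a $(d-k)$-sphere, i.e. $\hat K\in\mathcal{S}_{d-k}$.
   Context: All graphs are finite simple graphs. For a vertex $x$, $S(x)$ is the subgraph induced by the neighbors of $x$. Contractibility: $K_1$ is contractible, and $G$ is contractible if it has a vertex $x$ with $S(x)$ and $G-\{x\}$ both contractible. Spheres: $\mathcal{S}_{ -1}=\{\emptyset\}$; for $d\ge0$, $G\in\mathcal{S}_d$ if $S(x)\in\mathcal{S}_{d-1}$ for all vertices $x$ and $G-\{v\}$ is contractible for some vertex $v$. A $d$-dimensional geometric graph is a graph in which every unit sphere $S(x)$ belongs to $\mathcal{S}_{d-1}$. For a subgraph $H$ of $G$, the dual graph $\hat H$ is the intersection of the unit spheres $S(y)$ over all vertices $y$ of $H$, i.e. the subgraph of $G$ induced by the vertices adjacent to every vertex of $H$. -}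

module Defs where

open import Data.Bool using (Bool; true; false; _∧_; _∨_; not)
open import Data.Nat using (ℕ; zero; suc)
open import Data.Integer using (ℤ; +_; -[1+_])
open import Data.Fin using (Fin; zero; suc)
open import Data.Fin.Subset using (Subset; _∈_; _∉_; _∩_; _-_; ⁅_⁆; ⊤; ∣_∣)
open import Data.Vec using (tabulate)
open import Data.Product using (Σ; _×_; ∃)
open import Data.Empty using (⊥)
open import Relation.Binary.PropositionalEquality using (_≡_)

record Graph (n : ℕ) : Set where
  field
    adj   : Fin n → Fin n → Bool
    sym   : ∀ x y → adj x y ≡ adj y x
    irrefl : ∀ x → adj x x ≡ false
open Graph public

-- All subgraphs considered are induced subgraphs of a fixed graph G,
-- represented by their vertex set V : Subset n.

nbr : ∀ {n} → Graph n → Fin n → Subset n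
nbr G x = tabulate (adj G x)

unitSphere : ∀ {n} → Graph n → Subset n → Fin n → Subset n
unitSphere G V x = V ∩ nbr G x

data Contractible {n : ℕ} (G : Graph n) : Subset n → Set where
  k1   : ∀ {V} (x : Fin n) → V ≡ ⁅ x ⁆ → Contractible G V
  step : ∀ {V} (x : Fin n) → x ∈ V →
         Contractible G (unitSphere G V x) → Contractible G (V - x) →
         Contractible G V

-- SphereN m V  means  V ∈ 𝒮_(m-1)  (shifted index so that m = 0 is 𝒮_{-1}).
SphereN : ∀ {n} → Graph n → ℕ → Subset n → Set
SphereN G zero    V = ∀ x → x ∉ V
SphereN G (suc m) V =
  (∀ x → x ∈ V → SphereN G m (unitSphere G V x)) ×
  (Σ (Fin _) λ v → v ∈ V × Contractible G (V - v))

-- Sphere d V  means  V ∈ 𝒮_d  for an integer d (𝒮_d is empty for d < -1).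
Sphere : ∀ {n} → Graph n → ℤ → Subset n → Set
Sphere G (+ m)          V = SphereN G (suc m) V
Sphere G -[1+ zero ]    V = SphereN G zero V
Sphere G -[1+ suc _ ]   V = ⊥

Geometric : ∀ {n} → Graph n → ℕ → Set
Geometric G d = ∀ x → SphereN G d (unitSphere G ⊤ x)

IsComplete : ∀ {n} → Graph n → Subset n → Set
IsComplete G K = ∀ x y → x ∈ K → y ∈ K → x ≡ y ⊎' adj G x y ≡ true
  where
  open import Data.Sum using () renaming (_⊎_ to _⊎'_)

allFin : ∀ {n} → (Fin n → Bool) → Bool
allFin {zero}  f = true
allFin {suc n} f = f zero ∧ allFin (λ i → f (suc i))

dual : ∀ {n} → Graph n → Subset n → Subset n
dual G K = tabulate λ z → allFin λ y → not (Data.Vec.lookup K y) ∨ adj G y z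
  where import Data.Vec

module Submission where

-- Let K be a clique with j+1 vertices and y ∈ K. A vertex is adjacent to all
-- of K iff it is adjacent to all of K - y and to y, so
--     K̂ = S(y) taken inside the dual of K - y        (dual-peel),
-- and completeness of K puts y itself into the dual of K - y.  Hence K̂ is a
-- unit sphere of the smaller dual, and one induction on j finishes:
--   * j = 0: K - y = ∅ has dual G, so K̂ = S(y) ∈ 𝒮_{d-1} by geometricity;
--   * j > 0: the dual of K - y lies in 𝒮_{d-j} by induction, and a unit
--     sphere of a sphere in 𝒮_i lies in 𝒮_{i-1}        (sphere-link).

open import Defs
open import Data.Nat using (ℕ; _≥_)
open import Data.Integer using (+_; _-_)
open import Data.Fin.Subset using (Subset; ∣_∣)
open import Relation.Binary.PropositionalEquality using (_≡_)

open import Data.Nat using (zero; suc; _<_; s≤s; z≤n)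
open import Data.Nat.Properties using (suc-injective; n≮0)
open import Data.Integer using (-[1+_]; pred)
open import Data.Integer.Properties using (minus-suc)
open import Data.Bool using (Bool; true; false; _∨_; not)
open import Data.Fin using (Fin; _≟_)
open import Data.Fin.Subset
  using (_∈_; _∉_; _⊆_; _─_; ⁅_⁆; ⊤; ⊥; Nonempty; outside; inside)
  renaming (_-_ to _∖_)
open import Data.Fin.Subset.Properties
  using ( x∈p∩q⁺; x∈p∩q⁻; ⊆-antisym; p─q⊆p; x∈p∧x∉q⇒x∈p─q; x≢y⇒x∉⁅y⁆; x∈⁅x⁆
        ; ∈⊤; ∉⊥; p─⊥≡p; nonempty?; Empty-unique; ∣⊥∣≡0; x∈p⇒∣p-x∣<∣p∣ )
open import Data.Vec using (_∷_; lookup; _[_]=_)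
open import Data.Vec.Properties using ([]=⇒lookup; lookup⇒[]=; lookup∘tabulate)
open _[_]=_
open import Data.Product using (_×_; _,_)
open import Data.Sum using (_⊎_; inj₁; inj₂)
open import Data.Empty using (⊥-elim)
open import Relation.Nullary using (yes; no; contradiction)
open import Relation.Binary.PropositionalEquality using (refl; trans; cong; subst) renaming (sym to ≡-sym)

module _ {n : ℕ} (G : Graph n) where

  AdjacentToAll : Subset n → Fin n → Set
  AdjacentToAll K z = ∀ y → y ∈ K → adj G y z ≡ true

  ∈nbr⁺ : ∀ {x z} → adj G x z ≡ true → z ∈ nbr G x
  ∈nbr⁺ {x} {z} e = lookup⇒[]= z _ (trans (lookup∘tabulate (adj G x) z) e)

  ∈nbr⁻ : ∀ {x z} → z ∈ nbr G x → adj G x z ≡ true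
  ∈nbr⁻ {x} {z} z∈ = trans (≡-sym (lookup∘tabulate (adj G x) z)) ([]=⇒lookup z∈)

  ∈unitSphere⁺ : ∀ {V x z} → z ∈ V → adj G x z ≡ true → z ∈ unitSphere G V x
  ∈unitSphere⁺ z∈V xz = x∈p∩q⁺ (z∈V , ∈nbr⁺ xz)

  ∈unitSphere⁻ : ∀ {V x z} → z ∈ unitSphere G V x → z ∈ V × adj G x z ≡ true
  ∈unitSphere⁻ {V} {x} z∈ with x∈p∩q⁻ V (nbr G x) z∈
  ... | z∈V , z∈nbr = z∈V , ∈nbr⁻ z∈nbr

  private
    allFin⁺ : ∀ {m} (f : Fin m → Bool) → (∀ w → f w ≡ true) → allFin f ≡ true
    allFin⁺ {zero}  f h = refl
    allFin⁺ {suc m} f h rewrite h Fin.zero = allFin⁺ (λ w → f (Fin.suc w)) (λ w → h (Fin.suc w))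

    allFin⁻ : ∀ {m} (f : Fin m → Bool) → allFin f ≡ true → ∀ w → f w ≡ true
    allFin⁻ {suc m} f e w with f Fin.zero in f₀ | e
    allFin⁻ {suc m} f e Fin.zero    | true | _    = f₀
    allFin⁻ {suc m} f e (Fin.suc w) | true | rest = allFin⁻ (λ i → f (Fin.suc i)) rest w

    implies⁺ : ∀ b c → (b ≡ true → c ≡ true) → not b ∨ c ≡ true
    implies⁺ true  c h = h refl
    implies⁺ false c h = refl

    implies⁻ : ∀ b c → not b ∨ c ≡ true → b ≡ true → c ≡ true
    implies⁻ true c e refl = e

    lookupDual : ∀ K z → lookup (dual G K) z ≡ allFin (λ y → not (lookup K y) ∨ adj G y z)
    lookupDual K z = lookup∘tabulate _ z

  ∈dual⁺ : ∀ {K z} → AdjacentToAll K z → z ∈ dual G K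
  ∈dual⁺ {K} {z} h = lookup⇒[]= z _ (trans (lookupDual K z)
    (allFin⁺ _ λ y → implies⁺ _ _ λ y∈K → h y (lookup⇒[]= y K y∈K)))

  ∈dual⁻ : ∀ {K z} → z ∈ dual G K → AdjacentToAll K z
  ∈dual⁻ {K} {z} z∈ y y∈K = implies⁻ _ _
    (allFin⁻ _ (trans (≡-sym (lookupDual K z)) ([]=⇒lookup z∈)) y) ([]=⇒lookup y∈K)

  dual-⊥ : dual G ⊥ ≡ ⊤
  dual-⊥ = ⊆-antisym (λ _ → ∈⊤) (λ _ → ∈dual⁺ λ y y∈⊥ → ⊥-elim (∉⊥ y∈⊥))

  dual-peel : ∀ {K y} → y ∈ K → dual G K ≡ unitSphere G (dual G (K ∖ y)) y
  dual-peel {K} {y} y∈K = ⊆-antisym peel unpeel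
    where
    peel : dual G K ⊆ unitSphere G (dual G (K ∖ y)) y
    peel z∈ = ∈unitSphere⁺ (∈dual⁺ λ w w∈ → ∈dual⁻ z∈ w (p─q⊆p K ⁅ y ⁆ w∈)) (∈dual⁻ z∈ y y∈K)

    unpeel : unitSphere G (dual G (K ∖ y)) y ⊆ dual G K
    unpeel {z} z∈ with ∈unitSphere⁻ z∈
    ... | z∈dual , yz = ∈dual⁺ adjacent
      where
      adjacent : AdjacentToAll K z
      adjacent w w∈K with w ≟ y
      ... | yes refl = yz
      ... | no w≢y = ∈dual⁻ z∈dual w (x∈p∧x∉q⇒x∈p─q w∈K (x≢y⇒x∉⁅y⁆ w≢y))

  SphereN⇒Sphere : ∀ m {V} → SphereN G m V → Sphere G (pred (+ m)) V
  SphereN⇒Sphere zero    s = s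
  SphereN⇒Sphere (suc m) s = s

  -- A unit sphere of a sphere in 𝒮_i is a sphere in 𝒮_{i-1}; the cases
  -- i = -1 (V empty) and i < -1 (no spheres) are vacuous.
  sphere-link : ∀ i {V x} → Sphere G i V → x ∈ V → Sphere G (pred i) (unitSphere G V x)
  sphere-link (+ m)            (links , _) x∈V = SphereN⇒Sphere m (links _ x∈V)
  sphere-link -[1+ zero ]      empty       x∈V = contradiction x∈V (empty _)
  sphere-link -[1+ suc _ ]     ()

  clique-⊆ : ∀ {K L} → L ⊆ K → IsComplete G K → IsComplete G L
  clique-⊆ L⊆K clique x y x∈L y∈L = clique x y (L⊆K x∈L) (L⊆K y∈L)

x∈p─q⇒x∉q : ∀ {m} (p q : Subset m) {x} → x ∈ p ─ q → x ∉ q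
x∈p─q⇒x∉q (_ ∷ p) (outside ∷ q) here      ()
x∈p─q⇒x∉q (_ ∷ p) (inside  ∷ q) ()        here
x∈p─q⇒x∉q (_ ∷ p) (_       ∷ q) (there x∈) (there x∈q) = x∈p─q⇒x∉q p q x∈ x∈q

∣p∣≡1+∣p-x∣ : ∀ {m} (p : Subset m) {x} → x ∈ p → ∣ p ∣ ≡ suc ∣ p ∖ x ∣
∣p∣≡1+∣p-x∣ (inside ∷ p)  here       = cong (λ q → suc ∣ q ∣) (≡-sym (p─⊥≡p p))
∣p∣≡1+∣p-x∣ (inside ∷ p)  (there x∈) = cong suc (∣p∣≡1+∣p-x∣ p x∈)
∣p∣≡1+∣p-x∣ (outside ∷ p) (there x∈) = ∣p∣≡1+∣p-x∣ p x∈

∣p∣≡0⇒p≡⊥ : ∀ {m} (p : Subset m) → ∣ p ∣ ≡ 0 → p ≡ ⊥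
∣p∣≡0⇒p≡⊥ p ∣p∣≡0 = Empty-unique λ (x , x∈p) →
  n≮0 (subst (∣ p ∖ x ∣ <_) ∣p∣≡0 (x∈p⇒∣p-x∣<∣p∣ x∈p))

∣p∣≡1+k⇒Nonempty : ∀ {m} (p : Subset m) {k} → ∣ p ∣ ≡ suc k → Nonempty p
∣p∣≡1+k⇒Nonempty {m} p ∣p∣≡1+k with nonempty? p
... | yes ne = ne
... | no  ¬ne with trans (≡-sym ∣p∣≡1+k) (trans (cong ∣_∣ (Empty-unique ¬ne)) (∣⊥∣≡0 m))
...   | ()

dual-of-clique : ∀ {n} (G : Graph n) d → Geometric G d →
                 ∀ j K → ∣ K ∣ ≡ suc j → IsComplete G K → Sphere G (+ d - + suc j) (dual G K)
dual-of-clique G d geo j K ∣K∣ clique with ∣p∣≡1+k⇒Nonempty K ∣K∣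
... | y , y∈K = subst (Sphere G (+ d - + suc j)) (≡-sym (dual-peel G y∈K)) (peeled j ∣K∖y∣)
  where
  ∣K∖y∣ : ∣ K ∖ y ∣ ≡ j
  ∣K∖y∣ = suc-injective (trans (≡-sym (∣p∣≡1+∣p-x∣ K y∈K)) ∣K∣)

  y∈dual : y ∈ dual G (K ∖ y)
  y∈dual = ∈dual⁺ G λ w w∈ → adjacentToY (clique w y (p─q⊆p K ⁅ y ⁆ w∈) y∈K) w∈
    where
    adjacentToY : ∀ {w} → (w ≡ y) ⊎ (adj G w y ≡ true) → w ∈ K ∖ y → adj G w y ≡ true
    adjacentToY (inj₁ refl) w∈ = contradiction (x∈⁅x⁆ y) (x∈p─q⇒x∉q K ⁅ y ⁆ w∈)
    adjacentToY (inj₂ wy)   _  = wy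

  peeled : ∀ j → ∣ K ∖ y ∣ ≡ j → Sphere G (+ d - + suc j) (unitSphere G (dual G (K ∖ y)) y)
  peeled zero    ∣K∖y∣≡0 =
    subst (λ V → Sphere G (+ d - + 1) (unitSphere G V y))
          (≡-sym (trans (cong (dual G) (∣p∣≡0⇒p≡⊥ (K ∖ y) ∣K∖y∣≡0)) (dual-⊥ G)))
          (SphereN⇒Sphere G d (geo y))
  peeled (suc j) ∣K∖y∣≡1+j =
    subst (λ i → Sphere G i (unitSphere G (dual G (K ∖ y)) y)) (≡-sym (minus-suc (+ d) (suc j)))
          (sphere-link G (+ d - + suc j)
            (dual-of-clique G d geo j (K ∖ y) ∣K∖y∣≡1+j (clique-⊆ G (p─q⊆p K ⁅ y ⁆) clique))
            y∈dual)

mainTheorem7 : ∀ {n} (G : Graph n) (d : ℕ) → Geometric G d →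
               (K : Subset n) (k : ℕ) → k ≥ 1 → ∣ K ∣ ≡ k → IsComplete G K →
               Sphere G (+ d - + k) (dual G K)
mainTheorem7 G d geo K (suc j) (s≤s z≤n) ∣K∣ clique = dual-of-clique G d geo j K ∣K∣ clique
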